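{- Let $G=(V,E)$ be a finite simple undirected graph, let $k\ge 0$ be an integer and let $lb$ be an integer. If $\theta(G,k)\ge lb$ and there is an edge $\{u,v\}\in E$ such that $|N(u)\cap N(v)|\le lb-3$, then $\theta(G,k)=\theta((V,E\setminus\{\{u,v\}\}),k)$.
   Context: $N(x)=\{w:\{x,w\}\in E\}$ is the open neighborhood. For $S\subseteq V$, $G[S]$ is the induced subgraph; $\omega(H)$ is the size of a largest clique in $H$; and for a graph $G$ and nonnegative integer $k$, $\theta(G,k)=\min_{S\subseteq V,\ |S|\le k}\omega(G[V\setminus S])$. -}

module Defs where

open import Data.Nat using (ℕ; zero; suc; _≤ᵇ_; _⊔_; _⊓_)
open import Data.Bool using (Bool; true; false; _∧_; _∨_; not; if_then_else_)
open import Data.Fin using (Fin)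
open import Data.Fin.Properties using (_≟_)
open import Data.Bool.Properties using () renaming (_≟_ to _≟ᵇ_)
open import Data.Fin.Subset using (Subset; ∣_∣; ∁)
open import Data.Vec using (Vec; []; _∷_; lookup)
open import Data.List.Base using (List; []; _∷_; map; _++_; allFin; all; foldr; filter; length)
open import Relation.Nullary.Decidable using (⌊_⌋)
open import Relation.Binary.PropositionalEquality using (_≡_)

record Graph (n : ℕ) : Set where
  field
    adj    : Fin n → Fin n → Bool
    sym    : ∀ i j → adj i j ≡ adj j i
    irrefl : ∀ i → adj i i ≡ false
open Graph public

allSubsets : (n : ℕ) → List (Subset n)
allSubsets zero = [] ∷ []
allSubsets (suc n) = map (true ∷_) (allSubsets n) ++ map (false ∷_) (allSubsets n)

_∈ᵇ_ : ∀ {n} → Fin n → Subset n → Bool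
i ∈ᵇ S = lookup S i

_⊆ᵇ_ : ∀ {n} → Subset n → Subset n → Bool
_⊆ᵇ_ {n} C T = all (λ i → not (i ∈ᵇ C) ∨ (i ∈ᵇ T)) (allFin n)

isClique : ∀ {n} → (Fin n → Fin n → Bool) → Subset n → Bool
isClique {n} a C =
  all (λ i → all (λ j → not (i ∈ᵇ C) ∨ not (j ∈ᵇ C) ∨ ⌊ i ≟ j ⌋ ∨ a i j) (allFin n)) (allFin n)

ω : ∀ {n} → (Fin n → Fin n → Bool) → Subset n → ℕ
ω {n} a T = foldr (λ C m → (if (C ⊆ᵇ T) ∧ isClique a C then ∣ C ∣ else 0) ⊔ m) 0 (allSubsets n)

-- θ(G,k) = min over S ⊆ V with |S| ≤ k of ω(G[V ∖ S]).
-- (S = ∅ always qualifies; the fold starts at n, an upper bound for every ω.)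
θ : ∀ {n} → (Fin n → Fin n → Bool) → ℕ → ℕ
θ {n} a k = foldr (λ S m → (if ∣ S ∣ ≤ᵇ k then ω a (∁ S) else n) ⊓ m) n (allSubsets n)

commonNbrs : ∀ {n} → Graph n → Fin n → Fin n → ℕ
commonNbrs {n} G u v = length (filter (λ w → (adj G u w ∧ adj G v w) ≟ᵇ true) (allFin n))

deleteEdge : ∀ {n} → Graph n → Fin n → Fin n → (Fin n → Fin n → Bool)
deleteEdge G u v i j =
  adj G i j ∧ not ((⌊ i ≟ u ⌋ ∧ ⌊ j ≟ v ⌋) ∨ (⌊ i ≟ v ⌋ ∧ ⌊ j ≟ u ⌋))

-- A clique through both ends of the edge uv consists of u, v and common
-- neighbours of u and v, so it has at most |N(u) ∩ N(v)| + 2 ≤ lb - 1 vertices.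
-- For every admissible deletion set S we have ω(G - S) ≥ θ(G,k) ≥ lb, so a
-- maximum clique of G - S cannot contain both u and v and is still a clique
-- once uv is deleted. Deleting an edge never increases ω, hence ω(G - S) is
-- unchanged for every admissible S, and so is the minimum θ(G,k).

module Submission where

open import Defs hiding (sym)
open import Data.Nat using (ℕ)
open import Data.Fin using (Fin)
open import Data.Bool using (true)
open import Data.Integer using (ℤ; +_; _-_; _≤_)
open import Relation.Binary.PropositionalEquality using (_≡_)

open import Data.Bool using (Bool; false; T; _∧_; _∨_; not; if_then_else_)
open import Data.Bool.Properties using (T-∧) renaming (_≟_ to _≟ᵇ_)
open import Data.Empty using (⊥-elim)
open import Data.Fin using (zero; suc)
open import Data.Fin.Properties using (_≟_)
open import Data.Fin.Subset using (Subset; _∈_; _∪_; ⁅_⁆; ∣_∣; ∁)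
open import Data.Fin.Subset.Properties using (p⊆q⇒∣p∣≤∣q∣; ∣p∣≤∣x∷p∣; x∈⁅x⁆; ∣⁅x⁆∣≡1; x∈p∪q⁺)
import Data.Integer as ℤ
import Data.Integer.Properties as ℤₚ
open import Algebra.Properties.AbelianGroup ℤₚ.+-0-abelianGroup using (//-rightDividesˡ)
open import Data.List.Base using (List; []; _∷_; map; allFin; foldr; filter; length)
open import Data.Bool.ListAction using (all)
import Data.List.Base as List
open import Data.List.Membership.Propositional using () renaming (_∈_ to _∈ˡ_)
open import Data.List.Membership.Propositional.Properties using (∈-map⁺; ∈-++⁺ˡ; ∈-++⁺ʳ)
open import Data.List.Relation.Unary.All.Properties using (all⁺; all⁻; tabulate⁺; tabulate⁻)
open import Data.List.Relation.Unary.Any using (here; there)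
open import Data.Nat using (zero; suc; _+_; _⊔_; _⊓_; _≤ᵇ_; z≤n; s≤s) renaming (_≤_ to _≤ℕ_)
open import Data.Nat.Properties
  using (≤-refl; ≤-reflexive; ≤-trans; ≤-antisym; ≤-total; <⇒≱; ≤ᵇ⇒≤; ≤⇒≤ᵇ; +-comm; +-suc;
         +-monoʳ-≤; m≤m⊔n; m≤n⊔m; ⊔-mono-≤; m≤n⇒m⊔n≡n; m≥n⇒m⊔n≡m; m⊓n≤m; m⊓n≤n;
         module ≤-Reasoning)
open import Data.Product using (_×_; _,_; proj₁; ∃-syntax)
open import Data.Sum using (_⊎_; inj₁; inj₂)
open import Data.Unit using (tt)
open import Data.Vec using ([]; _∷_; lookup; tabulate)
open import Data.Vec.Properties using (lookup∘tabulate; []=⇒lookup; lookup⇒[]=)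
open import Function using (_∘_; _⇔_; mk⇔; Equivalence)
open import Relation.Nullary using (Dec; yes; no; ¬_)
open import Relation.Nullary.Decidable using (⌊_⌋)
open import Relation.Binary.PropositionalEquality
  using (_≢_; refl; sym; trans; cong; cong₂; subst; ≢-sym)

open Equivalence using (to; from)

private
  variable
    A : Set
    n : ℕ

maxOf : (A → ℕ) → List A → ℕ
maxOf f = foldr (λ x m → f x ⊔ m) 0

minOf : ℕ → (A → ℕ) → List A → ℕ
minOf m₀ f = foldr (λ x m → f x ⊓ m) m₀

maxOf-upper : ∀ (f : A → ℕ) {x xs} → x ∈ˡ xs → f x ≤ℕ maxOf f xs
maxOf-upper f (here refl) = m≤m⊔n _ _
maxOf-upper f {xs = y ∷ _} (there x∈xs) = ≤-trans (maxOf-upper f x∈xs) (m≤n⊔m (f y) _)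

maxOf-mono : ∀ {f g : A → ℕ} → (∀ x → f x ≤ℕ g x) → ∀ xs → maxOf f xs ≤ℕ maxOf g xs
maxOf-mono f≤g []       = z≤n
maxOf-mono f≤g (x ∷ xs) = ⊔-mono-≤ (f≤g x) (maxOf-mono f≤g xs)

maxOf-attained : ∀ (f : A → ℕ) xs → maxOf f xs ≡ 0 ⊎ ∃[ x ] maxOf f xs ≡ f x
maxOf-attained f []       = inj₁ refl
maxOf-attained f (x ∷ xs) with ≤-total (f x) (maxOf f xs) | maxOf-attained f xs
... | inj₂ fx≥m | _                = inj₂ (x , m≥n⇒m⊔n≡m fx≥m)
... | inj₁ fx≤m | inj₁ m≡0         = inj₁ (trans (m≤n⇒m⊔n≡n fx≤m) m≡0)
... | inj₁ fx≤m | inj₂ (y , m≡fy)  = inj₂ (y , trans (m≤n⇒m⊔n≡n fx≤m) m≡fy)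

minOf-lower : ∀ m₀ (f : A → ℕ) {x xs} → x ∈ˡ xs → minOf m₀ f xs ≤ℕ f x
minOf-lower m₀ f (here refl) = m⊓n≤m _ _
minOf-lower m₀ f {xs = y ∷ _} (there x∈xs) = ≤-trans (m⊓n≤n (f y) _) (minOf-lower m₀ f x∈xs)

minOf-cong : ∀ m₀ {f g : A → ℕ} → (∀ x → f x ≡ g x) → ∀ xs → minOf m₀ f xs ≡ minOf m₀ g xs
minOf-cong m₀ f≡g []       = refl
minOf-cong m₀ f≡g (x ∷ xs) = cong₂ _⊓_ (f≡g x) (minOf-cong m₀ f≡g xs)

∈-allSubsets : (C : Subset n) → C ∈ˡ allSubsets n
∈-allSubsets []          = here refl
∈-allSubsets (true ∷ C)  = ∈-++⁺ˡ (∈-map⁺ (true ∷_) (∈-allSubsets C))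
∈-allSubsets {suc n} (false ∷ C) =
  ∈-++⁺ʳ (map (true ∷_) (allSubsets n)) (∈-map⁺ (false ∷_) (∈-allSubsets C))

if-true : ∀ {b} {x y : ℕ} → T b → (if b then x else y) ≡ x
if-true {true} _ = refl

if-congˡ : ∀ b {x x′ y : ℕ} → (T b → x ≡ x′) → (if b then x else y) ≡ (if b then x′ else y)
if-congˡ true  x≡x′ = x≡x′ tt
if-congˡ false _    = refl

if-mono : ∀ b c {m : ℕ} → (T b → T c) → (if b then m else 0) ≤ℕ (if c then m else 0)
if-mono false _     _   = z≤n
if-mono true  true  _   = ≤-refl
if-mono true  false b⇒c = ⊥-elim (b⇒c tt)

T-all-allFin : ∀ {p : Fin n → Bool} → T (all p (allFin n)) ⇔ (∀ i → T (p i))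
T-all-allFin {n} {p} = mk⇔ (λ h → tabulate⁻ (all⁺ p (allFin n) h)) (λ h → all⁻ p (tabulate⁺ h))

∈⇔T-lookup : ∀ {i} {C : Subset n} → i ∈ C ⇔ T (lookup C i)
∈⇔T-lookup {C = C} =
  mk⇔ (λ i∈C → subst T (sym ([]=⇒lookup i∈C)) tt) (λ t → lookup⇒[]= _ C (T-true t))
  where
  T-true : ∀ {b} → T b → b ≡ true
  T-true {true} _ = refl

∈-tabulate : ∀ {p : Fin n → Bool} {i} → T (p i) → i ∈ tabulate p
∈-tabulate {p = p} {i} t = from ∈⇔T-lookup (subst T (sym (lookup∘tabulate p i)) t)

T-not-∨ : ∀ x {y} → T (not x) → T (not y) → T (not (x ∨ y))
T-not-∨ false _ t = t

T-not-∧-dec : ∀ {P Q : Set} (p : Dec P) (q : Dec Q) → ¬ (P × Q) → T (not (⌊ p ⌋ ∧ ⌊ q ⌋))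
T-not-∧-dec (yes p) (yes q) ¬p×q = ¬p×q (p , q)
T-not-∧-dec (yes _) (no _)  _    = tt
T-not-∧-dec (no _)  _       _    = tt

Adjacency : ℕ → Set
Adjacency n = Fin n → Fin n → Bool

IsClique : Adjacency n → Subset n → Set
IsClique a C = ∀ {i j} → i ∈ C → j ∈ C → i ≢ j → T (a i j)

T-clique-clause : ∀ {P : Set} x y (d : Dec P) b →
  T (not x ∨ not y ∨ ⌊ d ⌋ ∨ b) ⇔ (T x → T y → ¬ P → T b)
T-clique-clause false _     _       _ = mk⇔ (λ _ ()) (λ _ → tt)
T-clique-clause true  false _       _ = mk⇔ (λ _ _ ()) (λ _ → tt)
T-clique-clause true  true  (yes p) _ = mk⇔ (λ _ _ _ ¬p → ⊥-elim (¬p p)) (λ _ → tt)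
T-clique-clause true  true  (no ¬p) _ = mk⇔ (λ t _ _ _ → t) (λ h → h tt tt ¬p)

isClique⇔IsClique : ∀ (a : Adjacency n) C → T (isClique a C) ⇔ IsClique a C
isClique⇔IsClique a C = mk⇔
  (λ h {i} {j} i∈C j∈C i≢j →
    to (T-clique-clause _ _ (i ≟ j) _) (to T-all-allFin (to T-all-allFin h i) j)
       (to ∈⇔T-lookup i∈C) (to ∈⇔T-lookup j∈C) i≢j)
  (λ h → from T-all-allFin λ i → from T-all-allFin λ j →
    from (T-clique-clause _ _ (i ≟ j) _)
      λ ti tj i≢j → h (from ∈⇔T-lookup ti) (from ∈⇔T-lookup tj) i≢j)

∣p∪q∣≤∣p∣+∣q∣ : ∀ (p q : Subset n) → ∣ p ∪ q ∣ ≤ℕ ∣ p ∣ + ∣ q ∣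
∣p∪q∣≤∣p∣+∣q∣ []          []          = z≤n
∣p∪q∣≤∣p∣+∣q∣ (true  ∷ p) (y     ∷ q) =
  s≤s (≤-trans (∣p∪q∣≤∣p∣+∣q∣ p q) (+-monoʳ-≤ ∣ p ∣ (∣p∣≤∣x∷p∣ y q)))
∣p∪q∣≤∣p∣+∣q∣ (false ∷ p) (true  ∷ q) =
  ≤-trans (s≤s (∣p∪q∣≤∣p∣+∣q∣ p q)) (≤-reflexive (sym (+-suc ∣ p ∣ ∣ q ∣)))
∣p∪q∣≤∣p∣+∣q∣ (false ∷ p) (false ∷ q) = ∣p∪q∣≤∣p∣+∣q∣ p q

commonNeighbours : Adjacency n → Fin n → Fin n → Subset n
commonNeighbours a u v = tabulate (λ w → a u w ∧ a v w)

∣clique∣≤2+∣commonNeighbours∣ : ∀ (a : Adjacency n) {C u v} → IsClique a C → u ∈ C → v ∈ C →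
  ∣ C ∣ ≤ℕ 2 + ∣ commonNeighbours a u v ∣
∣clique∣≤2+∣commonNeighbours∣ a {C} {u} {v} clique u∈C v∈C = begin
  ∣ C ∣                                          ≤⟨ p⊆q⇒∣p∣≤∣q∣ C⊆uvN ⟩
  ∣ ⁅ u ⁆ ∪ ⁅ v ⁆ ∪ N ∣                          ≤⟨ ∣p∪q∣≤∣p∣+∣q∣ ⁅ u ⁆ _ ⟩
  ∣ ⁅ u ⁆ ∣ + ∣ ⁅ v ⁆ ∪ N ∣                      ≤⟨ +-monoʳ-≤ ∣ ⁅ u ⁆ ∣ (∣p∪q∣≤∣p∣+∣q∣ ⁅ v ⁆ N) ⟩
  ∣ ⁅ u ⁆ ∣ + (∣ ⁅ v ⁆ ∣ + ∣ N ∣)                ≡⟨ cong₂ (λ x y → x + (y + ∣ N ∣)) (∣⁅x⁆∣≡1 u) (∣⁅x⁆∣≡1 v) ⟩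
  2 + ∣ N ∣                                      ∎
  where
  open ≤-Reasoning
  N = commonNeighbours a u v
  C⊆uvN : ∀ {w} → w ∈ C → w ∈ ⁅ u ⁆ ∪ ⁅ v ⁆ ∪ N
  C⊆uvN {w} w∈C with w ≟ u | w ≟ v
  ... | yes refl | _        = x∈p∪q⁺ (inj₁ (x∈⁅x⁆ u))
  ... | no _     | yes refl = x∈p∪q⁺ (inj₂ (x∈p∪q⁺ (inj₁ (x∈⁅x⁆ v))))
  ... | no w≢u   | no w≢v   = x∈p∪q⁺ (inj₂ (x∈p∪q⁺ (inj₂ (∈-tabulate (from T-∧
    (clique u∈C w∈C (≢-sym w≢u) , clique v∈C w∈C (≢-sym w≢v)))))))

length-filter-tabulate : ∀ (p : A → Bool) (f : Fin n → A) →
  length (filter (λ x → p x ≟ᵇ true) (List.tabulate f)) ≡ ∣ tabulate (p ∘ f) ∣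
length-filter-tabulate {n = zero}  p f = refl
length-filter-tabulate {n = suc n} p f with p (f zero)
... | true  = cong suc (length-filter-tabulate p (f ∘ suc))
... | false = length-filter-tabulate p (f ∘ suc)

commonNbrs≡∣commonNeighbours∣ : ∀ (G : Graph n) u v →
  commonNbrs G u v ≡ ∣ commonNeighbours (adj G) u v ∣
commonNbrs≡∣commonNeighbours∣ G u v =
  length-filter-tabulate (λ w → adj G u w ∧ adj G v w) (λ w → w)

cliqueScore : Adjacency n → Subset n → Subset n → ℕ
cliqueScore a U C = if (C ⊆ᵇ U) ∧ isClique a C then ∣ C ∣ else 0

ω-upper : ∀ (a : Adjacency n) U C → T (C ⊆ᵇ U) → IsClique a C → ∣ C ∣ ≤ℕ ω a U
ω-upper a U C C⊆U clique =
  subst (_≤ℕ ω a U) (if-true (from T-∧ (C⊆U , from (isClique⇔IsClique a C) clique)))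
    (maxOf-upper (cliqueScore a U) (∈-allSubsets C))

ω-witness : ∀ (a : Adjacency n) U →
  ω a U ≡ 0 ⊎ ∃[ C ] T (C ⊆ᵇ U) × IsClique a C × ω a U ≡ ∣ C ∣
ω-witness {n} a U with maxOf-attained (cliqueScore a U) (allSubsets n)
... | inj₁ ω≡0 = inj₁ ω≡0
... | inj₂ (C , ω≡score) with (C ⊆ᵇ U) ∧ isClique a C in inU
...   | false = inj₁ ω≡score
...   | true  = let C⊆U , clique = to T-∧ (subst T (sym inU) tt)
                in inj₂ (C , C⊆U , to (isClique⇔IsClique a C) clique , ω≡score)

ω-mono : ∀ (a b : Adjacency n) → (∀ {i j} → T (b i j) → T (a i j)) → ∀ U → ω b U ≤ℕ ω a U
ω-mono {n} a b b⊆a U = maxOf-mono score-mono (allSubsets n)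
  where
  score-mono : ∀ C → cliqueScore b U C ≤ℕ cliqueScore a U C
  score-mono C = if-mono ((C ⊆ᵇ U) ∧ isClique b C) ((C ⊆ᵇ U) ∧ isClique a C) λ t →
    let C⊆U , clique = to T-∧ t
        b-clique = to (isClique⇔IsClique b C) clique
    in from T-∧ (C⊆U , from (isClique⇔IsClique a C) λ i∈C j∈C i≢j → b⊆a (b-clique i∈C j∈C i≢j))

ω-transfer : ∀ (a b : Adjacency n) U →
  (∀ C → IsClique a C → ω a U ≤ℕ ∣ C ∣ → IsClique b C) → ω a U ≤ℕ ω b U
ω-transfer a b U maximum⇒b with ω-witness a U
... | inj₁ ω≡0 = subst (_≤ℕ _) (sym ω≡0) z≤n
... | inj₂ (C , C⊆U , clique , ω≡∣C∣) =
  subst (_≤ℕ _) (sym ω≡∣C∣)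
    (ω-upper b U C C⊆U (maximum⇒b C clique (subst (_≤ℕ ∣ C ∣) (sym ω≡∣C∣) ≤-refl)))

deleteEdge⇒adj : ∀ (G : Graph n) u v {i j} → T (deleteEdge G u v i j) → T (adj G i j)
deleteEdge⇒adj G u v = proj₁ ∘ to T-∧

IsClique-deleteEdge : ∀ (G : Graph n) u v {C} → IsClique (adj G) C → ¬ (u ∈ C × v ∈ C) →
  IsClique (deleteEdge G u v) C
IsClique-deleteEdge G u v {C} clique avoids {i} {j} i∈C j∈C i≢j =
  from T-∧ (clique i∈C j∈C i≢j , T-not-∨ _
    (T-not-∧-dec (i ≟ u) (j ≟ v) λ { (refl , refl) → avoids (i∈C , j∈C) })
    (T-not-∧-dec (i ≟ v) (j ≟ u) λ { (refl , refl) → avoids (j∈C , i∈C) }))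

ω-deleteEdge : ∀ (G : Graph n) u v U → 3 + commonNbrs G u v ≤ℕ ω (adj G) U →
  ω (adj G) U ≡ ω (deleteEdge G u v) U
ω-deleteEdge G u v U large =
  ≤-antisym (ω-transfer (adj G) (deleteEdge G u v) U maximum-avoids-uv)
    (ω-mono (adj G) (deleteEdge G u v) (deleteEdge⇒adj G u v) U)
  where
  maximum-avoids-uv : ∀ C → IsClique (adj G) C → ω (adj G) U ≤ℕ ∣ C ∣ →
    IsClique (deleteEdge G u v) C
  maximum-avoids-uv C clique maximum = IsClique-deleteEdge G u v clique λ (u∈C , v∈C) →
    <⇒≱ (≤-trans large maximum)
      (subst (λ c → ∣ C ∣ ≤ℕ 2 + c) (sym (commonNbrs≡∣commonNeighbours∣ G u v))
        (∣clique∣≤2+∣commonNeighbours∣ (adj G) clique u∈C v∈C))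

θ≤ω : ∀ (a : Adjacency n) k S → ∣ S ∣ ≤ℕ k → θ a k ≤ℕ ω a (∁ S)
θ≤ω {n} a k S ∣S∣≤k =
  subst (θ a k ≤ℕ_) (if-true (≤⇒≤ᵇ ∣S∣≤k))
    (minOf-lower n (λ S → if ∣ S ∣ ≤ᵇ k then ω a (∁ S) else n) (∈-allSubsets S))

θ-cong : ∀ (a b : Adjacency n) k → (∀ S → ∣ S ∣ ≤ℕ k → ω a (∁ S) ≡ ω b (∁ S)) → θ a k ≡ θ b k
θ-cong {n} a b k ω≡ω =
  minOf-cong n (λ S → if-congˡ (∣ S ∣ ≤ᵇ k) (ω≡ω S ∘ ≤ᵇ⇒≤ _ _)) (allSubsets n)

θ-deleteEdge : ∀ (G : Graph n) u v k → 3 + commonNbrs G u v ≤ℕ θ (adj G) k →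
  θ (adj G) k ≡ θ (deleteEdge G u v) k
θ-deleteEdge G u v k large = θ-cong (adj G) (deleteEdge G u v) k λ S ∣S∣≤k →
  ω-deleteEdge G u v (∁ S) (≤-trans large (θ≤ω (adj G) k S ∣S∣≤k))

i≤+o∧+m≤i-+n⇒n+m≤o : ∀ {i : ℤ} {m n o : ℕ} → i ≤ + o → + m ≤ i - + n → n + m ≤ℕ o
i≤+o∧+m≤i-+n⇒n+m≤o {i} {m} {n} {o} i≤o m≤i-n =
  subst (_≤ℕ o) (+-comm m n) (ℤₚ.drop‿+≤+ (begin
    + (m + n)          ≡⟨ ℤₚ.pos-+ m n ⟩
    + m ℤ.+ + n        ≤⟨ ℤₚ.+-monoˡ-≤ (+ n) m≤i-n ⟩
    (i - + n) ℤ.+ + n  ≡⟨ //-rightDividesˡ (+ n) i ⟩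
    i                  ≤⟨ i≤o ⟩
    + o                ∎))
  where open ℤₚ.≤-Reasoning

lemma5 : {n : ℕ} (G : Graph n) (k : ℕ) (lb : ℤ) (u v : Fin n) →
    lb ≤ + θ (adj G) k → adj G u v ≡ true → + commonNbrs G u v ≤ lb - + 3 →
    θ (adj G) k ≡ θ (deleteEdge G u v) k
lemma5 G k lb u v lb≤θ _ common≤lb-3 =
  θ-deleteEdge G u v k (i≤+o∧+m≤i-+n⇒n+m≤o lb≤θ common≤lb-3)
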